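{- Let $X$ be a finite set and let $\mathcal T''\prec\mathcal T'\prec\mathcal T$ be three topologies on $X$. Then $\mathcal T'/\mathcal T''\prec\mathcal T/\mathcal T''$, and the following equality of topologies on $X$ holds: $$\mathcal T/\mathcal T'=(\mathcal T/\mathcal T'')\big/(\mathcal T'/\mathcal T'').$$
   Context: For a topology $\mathcal T$ on a finite set $X$, the associated quasi-order is $x\le_{\mathcal T}y$ iff every open set containing $x$ contains $y$; topologies on $X$ correspond bijectively to quasi-orders (reflexive transitive relations) on $X$, the open sets being the final segments (sets $Y$ with $y\in Y,\ y\le z\Rightarrow z\in Y$). For two topologies $\mathcal T,\mathcal T'$ on $X$, write $\mathcal T'\prec\mathcal T$ ("$\mathcal T'$ is finer than $\mathcal T$") when every $\mathcal T$-open set is $\mathcal T'$-open, equivalently $x\le_{\mathcal T'}y\Rightarrow x\le_{\mathcal T}y$. For $\mathcal T'\prec\mathcal T$, the quotient $\mathcal T/\mathcal T'$ is the topology on the same set $X$ whose quasi-order is the transitive closure of the relation $x\,\mathcal R\,y\iff(x\le_{\mathcal T}y\text{ or }y\le_{\mathcal T'}x)$. -}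

module Defs where

open import Data.Nat using (ℕ)
open import Data.Fin using (Fin)
open import Data.Sum using (_⊎_)
open import Data.Product using (_×_)
open import Level using (0ℓ)
open import Relation.Binary.Core using (Rel)
open import Relation.Binary.Definitions using (Reflexive; Transitive)
open import Relation.Binary.Construct.Closure.Transitive using (TransClosure; [_]; _++_)
open import Data.Sum using (inj₁)

-- A topology on the finite set X = Fin n, given (via the standard bijection
-- recalled in the paper) by its associated quasi-order ≤_T:
-- a reflexive, transitive relation.
record Topology (n : ℕ) : Set₁ where
  field
    _≤_   : Rel (Fin n) 0ℓ
    refl  : Reflexive _≤_
    trans : Transitive _≤_

open Topology public

IsOpen : ∀ {n} → Topology n → (Fin n → Set) → Set
IsOpen T Y = ∀ {y z} → Y y → _≤_ T y z → Y z

-- T' ≺ T  ("T' is finer than T"):  x ≤_{T'} y ⇒ x ≤_T y.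
_≺_ : ∀ {n} → Topology n → Topology n → Set
T' ≺ T = ∀ x y → _≤_ T' x y → _≤_ T x y

QuotRel : ∀ {n} → Topology n → Topology n → Rel (Fin n) 0ℓ
QuotRel T T' x y = _≤_ T x y ⊎ _≤_ T' y x

quotient : ∀ {n} (T T' : Topology n) → T' ≺ T → Topology n
quotient T T' _ = record
  { _≤_   = TransClosure (QuotRel T T')
  ; refl  = [ inj₁ (Topology.refl T) ]
  ; trans = _++_
  }

_≐_ : ∀ {n} → Topology n → Topology n → Set
T₁ ≐ T₂ = ∀ x y → (_≤_ T₁ x y → _≤_ T₂ x y) × (_≤_ T₂ x y → _≤_ T₁ x y)

module Submission where

open import Defs
open import Data.Fin using (Fin)
open import Data.Nat using (ℕ)
open import Data.Product using (Σ; _,_)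
open import Data.Sum using (inj₁; inj₂)
open import Level using (0ℓ)
open import Relation.Binary.Core using (Rel)
open import Relation.Binary.Construct.Closure.Transitive using (TransClosure; [_]; _∷_)

-- T/U is the coarsest topology S with T ≺ S in which every U-inequality is
-- reversed, i.e. U ≺ op S. Both sides of the identity are compared with
-- each other through this universal property alone.

private
  variable
    n : ℕ

-- Stated for bare relations, since a topology cannot be inferred from its
-- quasi-order.
≺-trans : {R S U : Rel (Fin n) 0ℓ} →
          (∀ x y → R x y → S x y) → (∀ x y → S x y → U x y) → ∀ x y → R x y → U x y
≺-trans h h' x y p = h' x y (h x y p)

op : Topology n → Topology n
op T = record
  { _≤_   = λ x y → _≤_ T y x
  ; refl  = Topology.refl T
  ; trans = λ p q → Topology.trans T q p
  }

module _ (T U : Topology n) (h : U ≺ T) where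

  ≺-quotient : T ≺ quotient T U h
  ≺-quotient x y p = [ inj₁ p ]

  ≺-op-quotient : U ≺ op (quotient T U h)
  ≺-op-quotient x y p = [ inj₂ p ]

  quotient-least : (S : Topology n) → T ≺ S → U ≺ op S → quotient T U h ≺ S
  quotient-least S hT hU _ _ = closure-≤
    where
    generator-≤ : ∀ {x y} → QuotRel T U x y → _≤_ S x y
    generator-≤ (inj₁ p) = hT _ _ p
    generator-≤ (inj₂ p) = hU _ _ p

    closure-≤ : ∀ {x y} → TransClosure (QuotRel T U) x y → _≤_ S x y
    closure-≤ [ r ]   = generator-≤ r
    closure-≤ (r ∷ p) = Topology.trans S (generator-≤ r) (closure-≤ p)

lemma2p1 : (n : ℕ) (T T' T'' : Topology n) (h₁ : T'' ≺ T') (h₂ : T' ≺ T) →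
    Σ (quotient T' T'' h₁ ≺ quotient T T'' (λ x y p → h₂ x y (h₁ x y p))) λ h₃ →
    quotient T T' h₂ ≐ quotient (quotient T T'' (λ x y p → h₂ x y (h₁ x y p))) (quotient T' T'' h₁) h₃
lemma2p1 n T T' T'' h₁ h₂ = h₃ , λ x y → T/T'≺Q x y , Q≺T/T' x y
  where
  h₁₂ : T'' ≺ T
  h₁₂ = ≺-trans h₁ h₂

  T/T'' = quotient T T'' h₁₂
  T'/T'' = quotient T' T'' h₁
  T/T' = quotient T T' h₂

  h₃ : T'/T'' ≺ T/T''
  h₃ = quotient-least T' T'' h₁ T/T'' (≺-trans h₂ (≺-quotient T T'' h₁₂)) (≺-op-quotient T T'' h₁₂)

  Q = quotient T/T'' T'/T'' h₃

  T/T'≺Q : T/T' ≺ Q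
  T/T'≺Q = quotient-least T T' h₂ Q
    (≺-trans (≺-quotient T T'' h₁₂) (≺-quotient T/T'' T'/T'' h₃))
    (≺-trans (≺-quotient T' T'' h₁) (≺-op-quotient T/T'' T'/T'' h₃))

  T'/T''≺op-T/T' : T'/T'' ≺ op T/T'
  T'/T''≺op-T/T' = quotient-least T' T'' h₁ (op T/T')
    (≺-op-quotient T T' h₂) (≺-trans h₁₂ (≺-quotient T T' h₂))

  Q≺T/T' : Q ≺ T/T'
  Q≺T/T' = quotient-least T/T'' T'/T'' h₃ T/T'
    (quotient-least T T'' h₁₂ T/T' (≺-quotient T T' h₂) (≺-trans h₁ (≺-op-quotient T T' h₂)))
    T'/T''≺op-T/T'
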